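{- Let $k\ge 3$ and $n\ge k+2$ be integers. Then $F(G_{k,2}^{(n)}) > F(G_{k+1,2}^{(n)})$.
   Context: All graphs are finite and simple. The F-index of a graph $G$ is $F(G)=\sum_{v\in V(G)} d_G(v)^3$. "Attaching $m$ leaves to a vertex $x$" means adding $m$ new vertices each adjacent only to $x$. For $3\le k\le n-1$, $G_{k,2}^{(n)}$ is the $n$-vertex graph obtained from the cycle $C_k$ by attaching $n-k-1$ leaves to one cycle vertex $u$ and one leaf to a cycle vertex adjacent to $u$. -}

module Defs where

open import Data.Nat using (ℕ; zero; suc; _+_; _*_; _≤_; _<_; _≡ᵇ_; _<ᵇ_; _^_)
open import Data.Bool using (Bool; true; false; _∧_; _∨_; not; if_then_else_)
open import Data.Fin using (Fin; toℕ)
open import Data.List using (List; map; filter; length)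
open import Data.Nat.ListAction using (sum)
open import Data.List.Base using (allFin)
open import Relation.Binary.PropositionalEquality using (_≡_; refl)
open import Data.Bool.Properties using (∨-comm; ∧-zeroʳ)

record SimpleGraph (n : ℕ) : Set where
  field
    adj   : Fin n → Fin n → Bool
    sym   : ∀ u v → adj u v ≡ adj v u
    irrefl : ∀ v → adj v v ≡ false
open SimpleGraph public

degree : {n : ℕ} → SimpleGraph n → Fin n → ℕ
degree {n} G v = length (filter (λ w → Data.Bool.T? (adj G v w)) (allFin n))
  where import Data.Bool

Findex : {n : ℕ} → SimpleGraph n → ℕ
Findex {n} G = sum (map (λ v → degree G v ^ 3) (allFin n))

-- Adjacency of G_{k,2}^{(n)} on vertices 0..n-1 (as naturals):
--   * cycle C_k on 0,1,...,k-1 (i ~ i+1 for i+1<k, and 0 ~ k-1);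
--   * u = 0 carries the n-k-1 leaves k, k+1, ..., n-2;
--   * vertex 1 (adjacent to u on the cycle) carries the leaf n-1.
-- Intended for 3 ≤ k ≤ n-1.
private
  adjℕ₁ : ℕ → ℕ → ℕ → ℕ → Bool
  adjℕ₁ n k i j =
       ((suc i ≡ᵇ j) ∧ (j <ᵇ k))
    ∨ ((i ≡ᵇ 0) ∧ (suc j ≡ᵇ k))
    ∨ ((i ≡ᵇ 0) ∧ ((k ≡ᵇ j) ∨ (k <ᵇ j)) ∧ (suc j <ᵇ n))
    ∨ ((i ≡ᵇ 1) ∧ (suc j ≡ᵇ n))

adjG : ℕ → ℕ → ℕ → ℕ → Bool
adjG n k i j = (adjℕ₁ n k i j ∨ adjℕ₁ n k j i) ∧ not (i ≡ᵇ j)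

private
  ≡ᵇ-sym : ∀ i j → (i ≡ᵇ j) ≡ (j ≡ᵇ i)
  ≡ᵇ-sym zero zero = refl
  ≡ᵇ-sym zero (suc j) = refl
  ≡ᵇ-sym (suc i) zero = refl
  ≡ᵇ-sym (suc i) (suc j) = ≡ᵇ-sym i j

  ≡ᵇ-refl : ∀ i → (i ≡ᵇ i) ≡ true
  ≡ᵇ-refl zero = refl
  ≡ᵇ-refl (suc i) = ≡ᵇ-refl i

adjG-sym : ∀ n k i j → adjG n k i j ≡ adjG n k j i
adjG-sym n k i j
  rewrite ∨-comm (adjℕ₁ n k i j) (adjℕ₁ n k j i) | ≡ᵇ-sym i j = refl

adjG-irrefl : ∀ n k i → adjG n k i i ≡ false
adjG-irrefl n k i rewrite ≡ᵇ-refl i = ∧-zeroʳ _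

G[_,2]^ : (k n : ℕ) → SimpleGraph n
G[ k ,2]^ n = record
  { adj = λ u v → adjG n k (toℕ u) (toℕ v)
  ; sym = λ u v → adjG-sym n k (toℕ u) (toℕ v)
  ; irrefl = λ v → adjG-irrefl n k (toℕ v)
  }

-- With k = 3 + a and L = n − k − 1 leaves at u = 0, the graph G_{k,2}^{(n)} has degree L + 2
-- at u, 3 at the cycle neighbour 1 carrying a leaf, 2 at the other k − 2 cycle vertices and 1
-- at the n − k leaves, so F = (L + 2)³ + 3³ + (k − 2)·2³ + (n − k)·1³.  Passing from k to k + 1
-- turns a leaf of u into a cycle vertex, and F drops by (L + 2)³ − (L + 1)³ − 2³ + 1³ = 3L² + 9L,
-- which is positive because n ≥ k + 2 forces L ≥ 1.
--
-- The degrees are read off the Boolean adjacency by orienting every edge as in its definition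
-- (cycle steps i → i + 1, the closing edge 0 → k − 1, and the edges from 0 and from 1 to their
-- leaves).  The four families of arcs are pairwise disjoint and no edge is oriented both ways,
-- so a degree is an out-degree plus an in-degree, each a sum of Iverson brackets.
module Submission where

open import Defs using (degree; Findex; adjG; G[_,2]^)
open import Data.Nat
  using (ℕ; zero; suc; _+_; _*_; _^_; _≤_; _<_; _>_; _≡ᵇ_; _<ᵇ_; s≤s; s≤s⁻¹; z<s; s<s; _<?_; _≟_)
open import Data.Nat.Properties
open import Data.Nat.ListAction using (sum)
open import Data.Nat.Tactic.RingSolver using (solve-∀)
open import Data.Bool using (Bool; true; false; _∧_; _∨_; not; T; T?)
open import Data.Bool.Properties using (T-∧; T-∨; ∧-zeroʳ)
open import Data.Fin using (Fin; toℕ)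
open import Data.List using ([]; _∷_; map; filter; length; tabulate; allFin)
open import Data.List.Properties using (map-tabulate; map-cong)
open import Data.Empty using (⊥; ⊥-elim)
open import Data.Product using (_×_; _,_) renaming (map to map-×)
open import Data.Sum using (inj₁; inj₂; [_,_]′)
open import Function using (_∘_; Equivalence)
open import Relation.Binary.PropositionalEquality
open import Relation.Nullary.Decidable using (dec-true; dec-false)
open import Algebra.Properties.CommutativeSemigroup +-commutativeSemigroup using (interchange)

⟦_⟧ : Bool → ℕ
⟦ true ⟧ = 1
⟦ false ⟧ = 0

∑< : ℕ → (ℕ → ℕ) → ℕ
∑< zero f = 0
∑< (suc n) f = f 0 + ∑< n (f ∘ suc)

syntax ∑< n (λ j → e) = ∑[ j < n ] e

count : ℕ → (ℕ → Bool) → ℕ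
count n p = ∑[ j < n ] ⟦ p j ⟧

∑<-cong : ∀ n {f g : ℕ → ℕ} → (∀ {j} → j < n → f j ≡ g j) → ∑< n f ≡ ∑< n g
∑<-cong zero eq = refl
∑<-cong (suc n) eq = cong₂ _+_ (eq z<s) (∑<-cong n (eq ∘ s<s))

∑<-distrib-+ : ∀ n (f g : ℕ → ℕ) → ∑[ j < n ] (f j + g j) ≡ ∑< n f + ∑< n g
∑<-distrib-+ zero f g = refl
∑<-distrib-+ (suc n) f g = trans (cong (f 0 + g 0 +_) (∑<-distrib-+ n (f ∘ suc) (g ∘ suc)))
                                 (interchange (f 0) (g 0) _ _)

∑<-const : ∀ n c → ∑[ j < n ] c ≡ n * c
∑<-const zero c = refl
∑<-const (suc n) c = cong (c +_) (∑<-const n c)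

∑<-suc : ∀ n (f : ℕ → ℕ) → ∑< (suc n) f ≡ ∑< n f + f n
∑<-suc zero f = +-comm (f 0) 0
∑<-suc (suc n) f = trans (cong (f 0 +_) (∑<-suc n (f ∘ suc))) (sym (+-assoc (f 0) _ _))

∑<-split : ∀ m n (f : ℕ → ℕ) → ∑< (m + n) f ≡ ∑< m f + ∑[ j < n ] f (m + j)
∑<-split zero n f = refl
∑<-split (suc m) n f = trans (cong (f 0 +_) (∑<-split m n (f ∘ suc))) (sym (+-assoc (f 0) _ _))

⟦⟧-∨ : ∀ b c → (T b → T c → ⊥) → ⟦ b ∨ c ⟧ ≡ ⟦ b ⟧ + ⟦ c ⟧
⟦⟧-∨ true true disj = ⊥-elim (disj _ _)
⟦⟧-∨ true false _ = refl
⟦⟧-∨ false c _ = refl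

⟦⟧-∧-not : ∀ b c → (T b → T c → ⊥) → ⟦ b ∧ not c ⟧ ≡ ⟦ b ⟧
⟦⟧-∧-not true true disj = ⊥-elim (disj _ _)
⟦⟧-∧-not true false _ = refl
⟦⟧-∧-not false c _ = refl

∧-implied : ∀ {a b} → (T b → T a) → a ∧ b ≡ b
∧-implied {true} _ = refl
∧-implied {false} {true} b⇒a = ⊥-elim (b⇒a _)
∧-implied {false} {false} _ = refl

≡ᵇ-comm : ∀ m n → (m ≡ᵇ n) ≡ (n ≡ᵇ m)
≡ᵇ-comm zero zero = refl
≡ᵇ-comm zero (suc n) = refl
≡ᵇ-comm (suc m) zero = refl
≡ᵇ-comm (suc m) (suc n) = ≡ᵇ-comm m n

≡ᵇ-∨-<ᵇ : ∀ m n → ((m ≡ᵇ n) ∨ (m <ᵇ n)) ≡ (m <ᵇ suc n)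
≡ᵇ-∨-<ᵇ zero zero = refl
≡ᵇ-∨-<ᵇ zero (suc n) = refl
≡ᵇ-∨-<ᵇ (suc m) zero = refl
≡ᵇ-∨-<ᵇ (suc m) (suc n) = ≡ᵇ-∨-<ᵇ m n

<ᵇ-true : ∀ {m n} → m < n → (m <ᵇ n) ≡ true
<ᵇ-true = dec-true (_ <? _)

<ᵇ-false : ∀ {m n} → n ≤ m → (m <ᵇ n) ≡ false
<ᵇ-false n≤m = dec-false (_ <? _) (≤⇒≯ n≤m)

≡ᵇ-true : ∀ m → (m ≡ᵇ m) ≡ true
≡ᵇ-true m = dec-true (m ≟ m) refl

≡ᵇ-false : ∀ {m n} → m ≢ n → (m ≡ᵇ n) ≡ false
≡ᵇ-false = dec-false (_ ≟ _)

count-false : ∀ n → count n (λ _ → false) ≡ 0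
count-false n = trans (∑<-const n 0) (*-zeroʳ n)

count-∨ : ∀ n (p q : ℕ → Bool) → (∀ j → T (p j) → T (q j) → ⊥) →
          count n (λ j → p j ∨ q j) ≡ count n p + count n q
count-∨ n p q disj = trans (∑<-cong n (λ {j} _ → ⟦⟧-∨ (p j) (q j) (disj j)))
                           (∑<-distrib-+ n (⟦_⟧ ∘ p) (⟦_⟧ ∘ q))

count-∧ˡ : ∀ n b (p : ℕ → Bool) → count n (λ j → b ∧ p j) ≡ ⟦ b ⟧ * count n p
count-∧ˡ n true p = sym (+-identityʳ _)
count-∧ˡ n false p = count-false n

count-≡ᵇ : ∀ n c → c < n → count n (λ j → j ≡ᵇ c) ≡ 1
count-≡ᵇ (suc n) zero _ = cong suc (count-false n)
count-≡ᵇ (suc n) (suc c) (s<s c<n) = count-≡ᵇ n c c<n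

count-≡ᵇ-∧ : ∀ n c (p : ℕ → Bool) → count n (λ j → (j ≡ᵇ c) ∧ p j) ≡ ⟦ (c <ᵇ n) ∧ p c ⟧
count-≡ᵇ-∧ zero c p = refl
count-≡ᵇ-∧ (suc n) zero p = trans (cong (⟦ p 0 ⟧ +_) (count-false n)) (+-identityʳ _)
count-≡ᵇ-∧ (suc n) (suc c) p = count-≡ᵇ-∧ n c (p ∘ suc)

count-<ᵇ : ∀ {l n} → l ≤ n → count n (λ j → j <ᵇ l) ≡ l
count-<ᵇ {zero} {n} _ = count-false n
count-<ᵇ {suc l} (s≤s l≤n) = cong suc (count-<ᵇ l≤n)

count-interval : ∀ m {l n} → m + l ≤ n → count n (λ j → (m <ᵇ suc j) ∧ (j <ᵇ m + l)) ≡ l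
count-interval zero h = count-<ᵇ h
count-interval (suc m) (s≤s h) = count-interval m h

length-filter-T? : ∀ {A : Set} (p : A → Bool) xs →
                   length (filter (T? ∘ p) xs) ≡ sum (map (⟦_⟧ ∘ p) xs)
length-filter-T? p [] = refl
length-filter-T? p (x ∷ xs) with p x
... | true = cong suc (length-filter-T? p xs)
... | false = length-filter-T? p xs

sum-tabulate-toℕ : ∀ n (f : ℕ → ℕ) → sum (tabulate {n = n} (f ∘ toℕ)) ≡ ∑< n f
sum-tabulate-toℕ zero f = refl
sum-tabulate-toℕ (suc n) f = cong (f 0 +_) (sum-tabulate-toℕ n (f ∘ suc))

sum-map-allFin : ∀ n (f : ℕ → ℕ) → sum (map (f ∘ toℕ) (allFin n)) ≡ ∑< n f
sum-map-allFin n f = trans (cong sum (map-tabulate {n = n} (λ i → i) (f ∘ toℕ)))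
                           (sum-tabulate-toℕ n f)

degree-as-count : ∀ k n (v : Fin n) → degree (G[ k ,2]^ n) v ≡ count n (adjG n k (toℕ v))
degree-as-count k n v = trans (length-filter-T? _ (allFin n)) (sum-map-allFin n _)

Findex-as-∑ : ∀ k n → Findex (G[ k ,2]^ n) ≡ ∑[ i < n ] (count n (adjG n k i) ^ 3)
Findex-as-∑ k n = trans (cong sum (map-cong (cong (_^ 3) ∘ degree-as-count k n) (allFin n)))
                        (sum-map-allFin n (λ i → count n (adjG n k i) ^ 3))

-- The graph G_{k,2}^{(n)} with k = 3 + a and n = k + L + 1, so that L leaves hang at u = 0.
module _ (a L : ℕ) where

  private
    k n : ℕ
    k = 3 + a
    n = 4 + a + L

    k<n : k < n
    k<n = +-monoʳ-≤ 4 (m≤m+n a L)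

  -- arc replicates the private adjℕ₁ of Defs: adjG n k x y is (arc x y ∨ arc y x) ∧ not (x ≡ᵇ y)
  -- by definition.
  pathArc closeArc leafArc₀ leafArc₁ arc : ℕ → ℕ → Bool
  pathArc x y = (suc x ≡ᵇ y) ∧ (y <ᵇ k)
  closeArc x y = (x ≡ᵇ 0) ∧ (suc y ≡ᵇ k)
  leafArc₀ x y = (x ≡ᵇ 0) ∧ ((k ≡ᵇ y) ∨ (k <ᵇ y)) ∧ (suc y <ᵇ n)
  leafArc₁ x y = (x ≡ᵇ 1) ∧ (suc y ≡ᵇ n)
  arc x y = pathArc x y ∨ closeArc x y ∨ leafArc₀ x y ∨ leafArc₁ x y

  isLeaf : ℕ → Bool
  isLeaf y = (k <ᵇ suc y) ∧ (y <ᵇ k + L)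

  leafArc₀-isLeaf : ∀ x y → leafArc₀ x y ≡ (x ≡ᵇ 0) ∧ isLeaf y
  leafArc₀-isLeaf x y = cong (λ b → (x ≡ᵇ 0) ∧ b ∧ (y <ᵇ k + L)) (≡ᵇ-∨-<ᵇ k y)

  pathArc⁻ : ∀ {x y} → T (pathArc x y) → suc x ≡ y × y < k
  pathArc⁻ = map-× (≡ᵇ⇒≡ _ _) (<ᵇ⇒< _ _) ∘ Equivalence.to T-∧

  closeArc⁻ : ∀ {x y} → T (closeArc x y) → x ≡ 0 × suc y ≡ k
  closeArc⁻ = map-× (≡ᵇ⇒≡ _ _) (≡ᵇ⇒≡ _ _) ∘ Equivalence.to T-∧

  isLeaf⁻ : ∀ {y} → T (isLeaf y) → k ≤ y × y < k + L
  isLeaf⁻ = map-× (s≤s⁻¹ ∘ <ᵇ⇒< _ _) (<ᵇ⇒< _ _) ∘ Equivalence.to T-∧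

  leafArc₀⁻ : ∀ {x y} → T (leafArc₀ x y) → x ≡ 0 × k ≤ y × y < k + L
  leafArc₀⁻ {x} {y} = map-× (≡ᵇ⇒≡ _ _) isLeaf⁻ ∘ Equivalence.to T-∧ ∘ subst T (leafArc₀-isLeaf x y)

  leafArc₁⁻ : ∀ {x y} → T (leafArc₁ x y) → x ≡ 1 × suc y ≡ n
  leafArc₁⁻ = map-× (≡ᵇ⇒≡ _ _) (≡ᵇ⇒≡ _ _) ∘ Equivalence.to T-∧

  data Arc : ℕ → ℕ → Set where
    path  : ∀ {x} → suc x < k → Arc x (suc x)
    close : Arc 0 (2 + a)
    leaf₀ : ∀ {y} → k ≤ y → y < k + L → Arc 0 y
    leaf₁ : Arc 1 (k + L)

  arc⁻ : ∀ {x y} → T (arc x y) → Arc x y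
  arc⁻ {x} {y} t with Equivalence.to T-∨ t
  ... | inj₁ t₁ with pathArc⁻ {x} {y} t₁
  ...   | refl , y<k = path y<k
  arc⁻ {x} {y} t | inj₂ t₂ with Equivalence.to T-∨ t₂
  ... | inj₁ t₃ with closeArc⁻ {x} {y} t₃
  ...   | refl , refl = close
  arc⁻ {x} {y} t | inj₂ t₂ | inj₂ t₄ with Equivalence.to T-∨ t₄
  ... | inj₁ t₅ with leafArc₀⁻ {x} {y} t₅
  ...   | refl , k≤y , y<k+L = leaf₀ k≤y y<k+L
  arc⁻ {x} {y} t | inj₂ t₂ | inj₂ t₄ | inj₂ t₆ with leafArc₁⁻ {x} {y} t₆
  ... | refl , refl = leaf₁

  arc-irrefl : ∀ {x} → Arc x x → ⊥
  arc-irrefl (leaf₀ () _)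

  arc-asym : ∀ {x y} → Arc x y → Arc y x → ⊥
  arc-asym (path _) ()
  arc-asym close ()
  arc-asym (leaf₀ () _) (leaf₀ _ _)
  arc-asym leaf₁ ()

  pathArc-disjoint : ∀ x y → T (pathArc x y) → T (closeArc x y ∨ leafArc₀ x y ∨ leafArc₁ x y) → ⊥
  pathArc-disjoint x y p q with pathArc⁻ {x} {y} p | Equivalence.to (T-∨ {closeArc x y}) q
  ... | refl , _ | inj₁ c with closeArc⁻ {x} {y} c
  ...   | refl , ()
  pathArc-disjoint x y p q | refl , _ | inj₂ q′ with Equivalence.to (T-∨ {leafArc₀ x y}) q′
  ... | inj₁ l with leafArc₀⁻ {x} {y} l
  ...   | refl , s≤s () , _
  pathArc-disjoint x y p q | refl , _ | inj₂ q′ | inj₂ l with leafArc₁⁻ {x} {y} l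
  ...   | refl , ()

  closeArc-disjoint : ∀ x y → T (closeArc x y) → T (leafArc₀ x y ∨ leafArc₁ x y) → ⊥
  closeArc-disjoint x y c q with closeArc⁻ {x} {y} c | Equivalence.to (T-∨ {leafArc₀ x y}) q
  ... | refl , refl | inj₁ l with leafArc₀⁻ {x} {y} l
  ...   | _ , k≤y , _ = 1+n≰n k≤y
  closeArc-disjoint x y c q | refl , _ | inj₂ l with leafArc₁⁻ {x} {y} l
  ...   | () , _

  leafArc₀-disjoint : ∀ x y → T (leafArc₀ x y) → T (leafArc₁ x y) → ⊥
  leafArc₀-disjoint x y l l′ with leafArc₀⁻ {x} {y} l | leafArc₁⁻ {x} {y} l′
  ... | refl , _ | () , _

  deg : ℕ → ℕ
  deg i = count n (adjG n k i)

  ⟦adjG⟧ : ∀ i j → ⟦ adjG n k i j ⟧ ≡ ⟦ arc i j ⟧ + ⟦ arc j i ⟧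
  ⟦adjG⟧ i j = trans (⟦⟧-∧-not (arc i j ∨ arc j i) (i ≡ᵇ j) no-loop)
                     (⟦⟧-∨ (arc i j) (arc j i) λ p q → arc-asym (arc⁻ {i} {j} p) (arc⁻ {j} {i} q))
    where
    no-loop : T (arc i j ∨ arc j i) → T (i ≡ᵇ j) → ⊥
    no-loop t e with ≡ᵇ⇒≡ i j e
    ... | refl = arc-irrefl ([ arc⁻ {i} {i} , arc⁻ {i} {i} ]′ (Equivalence.to (T-∨ {arc i i}) t))

  deg-out-in : ∀ i → deg i ≡ count n (arc i) + count n (λ j → arc j i)
  deg-out-in i = trans (∑<-cong n (λ {j} _ → ⟦adjG⟧ i j))
                       (∑<-distrib-+ n (λ j → ⟦ arc i j ⟧) (λ j → ⟦ arc j i ⟧))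

  count-arc : ∀ (s t : ℕ → ℕ) → count n (λ j → arc (s j) (t j)) ≡
              count n (λ j → pathArc (s j) (t j)) + (count n (λ j → closeArc (s j) (t j)) +
              (count n (λ j → leafArc₀ (s j) (t j)) + count n (λ j → leafArc₁ (s j) (t j))))
  count-arc s t = begin
    count n (λ j → along pathArc j ∨ along closeArc j ∨ along leafArc₀ j ∨ along leafArc₁ j)
      ≡⟨ count-∨ n (along pathArc) _ (λ j → pathArc-disjoint (s j) (t j)) ⟩
    count n (along pathArc) + count n (λ j → along closeArc j ∨ along leafArc₀ j ∨ along leafArc₁ j)
      ≡⟨ cong (count n (along pathArc) +_)
              (count-∨ n (along closeArc) _ (λ j → closeArc-disjoint (s j) (t j))) ⟩
    count n (along pathArc) + (count n (along closeArc) + count n (λ j → along leafArc₀ j ∨ along leafArc₁ j))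
      ≡⟨ cong (λ m → count n (along pathArc) + (count n (along closeArc) + m))
              (count-∨ n (along leafArc₀) (along leafArc₁) (λ j → leafArc₀-disjoint (s j) (t j))) ⟩
    count n (along pathArc) + (count n (along closeArc) + (count n (along leafArc₀) + count n (along leafArc₁)))
      ∎
    where
    open ≡-Reasoning
    along : (ℕ → ℕ → Bool) → ℕ → Bool
    along r j = r (s j) (t j)

  count-isLeaf : count n isLeaf ≡ L
  count-isLeaf = count-interval k {L} {n} (n≤1+n (k + L))

  out-degree : ∀ i → count n (arc i) ≡ ⟦ suc i <ᵇ k ⟧ + (⟦ i ≡ᵇ 0 ⟧ + (⟦ i ≡ᵇ 0 ⟧ * L + ⟦ i ≡ᵇ 1 ⟧))
  out-degree i = trans (count-arc (λ _ → i) (λ j → j))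
                       (cong₂ _+_ path-count (cong₂ _+_ close-count (cong₂ _+_ leaf₀-count leaf₁-count)))
    where
    open ≡-Reasoning
    path-count : count n (pathArc i) ≡ ⟦ suc i <ᵇ k ⟧
    path-count = begin
      count n (pathArc i)
        ≡⟨ ∑<-cong n (λ {j} _ → cong (λ b → ⟦ b ∧ (j <ᵇ k) ⟧) (≡ᵇ-comm (suc i) j)) ⟩
      count n (λ j → (j ≡ᵇ suc i) ∧ (j <ᵇ k))
        ≡⟨ count-≡ᵇ-∧ n (suc i) (_<ᵇ k) ⟩
      ⟦ (suc i <ᵇ n) ∧ (suc i <ᵇ k) ⟧
        ≡⟨ cong ⟦_⟧ (∧-implied (λ t → <⇒<ᵇ (<-trans (<ᵇ⇒< (suc i) k t) k<n))) ⟩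
      ⟦ suc i <ᵇ k ⟧ ∎
    close-count : count n (closeArc i) ≡ ⟦ i ≡ᵇ 0 ⟧
    close-count = begin
      count n (closeArc i)                     ≡⟨ count-∧ˡ n (i ≡ᵇ 0) (λ j → suc j ≡ᵇ k) ⟩
      ⟦ i ≡ᵇ 0 ⟧ * count n (λ j → j ≡ᵇ 2 + a)  ≡⟨ cong (⟦ i ≡ᵇ 0 ⟧ *_) (count-≡ᵇ n (2 + a) (<-trans (n<1+n _) k<n)) ⟩
      ⟦ i ≡ᵇ 0 ⟧ * 1                           ≡⟨ *-identityʳ _ ⟩
      ⟦ i ≡ᵇ 0 ⟧                               ∎
    leaf₀-count : count n (leafArc₀ i) ≡ ⟦ i ≡ᵇ 0 ⟧ * L
    leaf₀-count = begin
      count n (leafArc₀ i)                     ≡⟨ ∑<-cong n (λ {j} _ → cong ⟦_⟧ (leafArc₀-isLeaf i j)) ⟩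
      count n (λ j → (i ≡ᵇ 0) ∧ isLeaf j)      ≡⟨ count-∧ˡ n (i ≡ᵇ 0) isLeaf ⟩
      ⟦ i ≡ᵇ 0 ⟧ * count n isLeaf              ≡⟨ cong (⟦ i ≡ᵇ 0 ⟧ *_) count-isLeaf ⟩
      ⟦ i ≡ᵇ 0 ⟧ * L                           ∎
    leaf₁-count : count n (leafArc₁ i) ≡ ⟦ i ≡ᵇ 1 ⟧
    leaf₁-count = begin
      count n (leafArc₁ i)                     ≡⟨ count-∧ˡ n (i ≡ᵇ 1) (λ j → suc j ≡ᵇ n) ⟩
      ⟦ i ≡ᵇ 1 ⟧ * count n (λ j → j ≡ᵇ k + L)  ≡⟨ cong (⟦ i ≡ᵇ 1 ⟧ *_) (count-≡ᵇ n (k + L) ≤-refl) ⟩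
      ⟦ i ≡ᵇ 1 ⟧ * 1                           ≡⟨ *-identityʳ _ ⟩
      ⟦ i ≡ᵇ 1 ⟧                               ∎

  in-degree : ∀ i → count n (λ j → arc j i) ≡
              ⟦ (0 <ᵇ i) ∧ (i <ᵇ k) ⟧ + (⟦ suc i ≡ᵇ k ⟧ + (⟦ isLeaf i ⟧ + ⟦ suc i ≡ᵇ n ⟧))
  in-degree i = trans (count-arc (λ j → j) (λ _ → i))
                      (cong₂ _+_ (path-count i)
                      (cong₂ _+_ (count-≡ᵇ-∧ n 0 (λ _ → suc i ≡ᵇ k))
                      (cong₂ _+_ leaf₀-count (count-≡ᵇ-∧ n 1 (λ _ → suc i ≡ᵇ n)))))
    where
    path-count : ∀ i → count n (λ j → pathArc j i) ≡ ⟦ (0 <ᵇ i) ∧ (i <ᵇ k) ⟧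
    path-count zero = count-false n
    path-count (suc i) = trans (count-≡ᵇ-∧ n i (λ _ → suc i <ᵇ k))
      (cong ⟦_⟧ (∧-implied (λ t → <⇒<ᵇ (<-trans (<-trans (n<1+n i) (<ᵇ⇒< (suc i) k t)) k<n))))
    leaf₀-count : count n (λ j → leafArc₀ j i) ≡ ⟦ isLeaf i ⟧
    leaf₀-count = trans (∑<-cong n (λ {j} _ → cong ⟦_⟧ (leafArc₀-isLeaf j i)))
                        (count-≡ᵇ-∧ n 0 (λ _ → isLeaf i))

  deg-formula : ∀ i → deg i ≡ (⟦ suc i <ᵇ k ⟧ + (⟦ i ≡ᵇ 0 ⟧ + (⟦ i ≡ᵇ 0 ⟧ * L + ⟦ i ≡ᵇ 1 ⟧)))
                            + (⟦ (0 <ᵇ i) ∧ (i <ᵇ k) ⟧ + (⟦ suc i ≡ᵇ k ⟧ + (⟦ isLeaf i ⟧ + ⟦ suc i ≡ᵇ n ⟧)))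
  deg-formula i = trans (deg-out-in i) (cong₂ _+_ (out-degree i) (in-degree i))

  deg-0 : deg 0 ≡ 2 + L
  deg-0 = trans (deg-formula 0) (trans (+-identityʳ _) (cong (2 +_) (trans (+-identityʳ (L + 0)) (+-identityʳ L))))

  deg-1 : deg 1 ≡ 3
  deg-1 = deg-formula 1

  deg-inner : ∀ p {b₁ b₂ b₃ b₄ b₅} →
              (3 + p <ᵇ k) ≡ b₁ → (2 + p <ᵇ k) ≡ b₂ → (3 + p ≡ᵇ k) ≡ b₃ → isLeaf (2 + p) ≡ b₄ →
              (3 + p ≡ᵇ n) ≡ b₅ → deg (2 + p) ≡ ⟦ b₁ ⟧ + (⟦ b₂ ⟧ + (⟦ b₃ ⟧ + (⟦ b₄ ⟧ + ⟦ b₅ ⟧)))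
  deg-inner p refl refl refl refl refl =
    trans (deg-formula (2 + p)) (cong₂ _+_ (+-identityʳ ⟦ 3 + p <ᵇ k ⟧) refl)

  deg-path : ∀ {p} → p < a → deg (2 + p) ≡ 2
  deg-path {p} p<a =
    deg-inner p (<ᵇ-true 3+p<k) (<ᵇ-true (<-trans (n<1+n _) 3+p<k)) (≡ᵇ-false (<⇒≢ 3+p<k))
                (cong (_∧ (2 + p <ᵇ k + L)) (<ᵇ-false (<⇒≤ 3+p<k))) (≡ᵇ-false (<⇒≢ (<-trans 3+p<k k<n)))
    where
    3+p<k : 3 + p < k
    3+p<k = +-monoʳ-< 3 p<a

  deg-corner : deg (2 + a) ≡ 2
  deg-corner =
    deg-inner a (<ᵇ-false {k} ≤-refl) (<ᵇ-true {2 + a} ≤-refl) (≡ᵇ-true k)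
                (cong (_∧ (2 + a <ᵇ k + L)) (<ᵇ-false {k} ≤-refl)) (≡ᵇ-false (<⇒≢ k<n))

  deg-leaf : ∀ {j} → j < L → deg (k + j) ≡ 1
  deg-leaf {j} j<L =
    deg-inner (suc (a + j)) (<ᵇ-false (m≤n⇒m≤1+n k≤k+j)) (<ᵇ-false k≤k+j) (≡ᵇ-false (>⇒≢ (s≤s k≤k+j)))
                            (cong₂ _∧_ (<ᵇ-true (s≤s k≤k+j)) (<ᵇ-true (+-monoʳ-< k j<L)))
                            (≡ᵇ-false (<⇒≢ (s<s (+-monoʳ-< k j<L))))
    where
    k≤k+j : k ≤ k + j
    k≤k+j = m≤m+n k j

  deg-last : deg (k + L) ≡ 1
  deg-last =
    deg-inner (suc (a + L)) (<ᵇ-false (m≤n⇒m≤1+n k≤k+L)) (<ᵇ-false k≤k+L) (≡ᵇ-false (>⇒≢ (s≤s k≤k+L)))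
                            (trans (cong ((k <ᵇ suc (k + L)) ∧_) (<ᵇ-false {k + L} ≤-refl)) (∧-zeroʳ _))
                            (≡ᵇ-true n)
    where
    k≤k+L : k ≤ k + L
    k≤k+L = m≤m+n k L

  Findex-closed-form : Findex (G[ k ,2]^ n) ≡ (2 + L) ^ 3 + (3 ^ 3 + (a * 2 ^ 3 + 2 ^ 3)) + L * 1 ^ 3 + 1 ^ 3
  Findex-closed-form = begin
    Findex (G[ k ,2]^ n)
      ≡⟨ Findex-as-∑ k n ⟩
    ∑[ i < n ] (deg i ^ 3)
      ≡⟨ ∑<-suc (k + L) deg³ ⟩
    ∑[ i < k + L ] (deg i ^ 3) + deg (k + L) ^ 3
      ≡⟨ cong₂ _+_ (∑<-split k L deg³) (cong (_^ 3) deg-last) ⟩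
    ∑[ i < k ] (deg i ^ 3) + ∑[ j < L ] (deg (k + j) ^ 3) + 1 ^ 3
      ≡⟨ cong (_+ 1 ^ 3) (cong₂ _+_ cycle leaves) ⟩
    (2 + L) ^ 3 + (3 ^ 3 + (a * 2 ^ 3 + 2 ^ 3)) + L * 1 ^ 3 + 1 ^ 3 ∎
    where
    open ≡-Reasoning
    deg³ : ℕ → ℕ
    deg³ i = deg i ^ 3
    cycle : ∑[ i < k ] (deg i ^ 3) ≡ (2 + L) ^ 3 + (3 ^ 3 + (a * 2 ^ 3 + 2 ^ 3))
    cycle = begin
      deg 0 ^ 3 + (deg 1 ^ 3 + ∑[ p < suc a ] (deg (2 + p) ^ 3))
        ≡⟨ cong₂ _+_ (cong (_^ 3) deg-0) (cong₂ _+_ (cong (_^ 3) deg-1) (∑<-suc a (deg³ ∘ (2 +_)))) ⟩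
      (2 + L) ^ 3 + (3 ^ 3 + (∑[ p < a ] (deg (2 + p) ^ 3) + deg (2 + a) ^ 3))
        ≡⟨ cong (λ m → (2 + L) ^ 3 + (3 ^ 3 + m)) (cong₂ _+_ path-vertices (cong (_^ 3) deg-corner)) ⟩
      (2 + L) ^ 3 + (3 ^ 3 + (a * 2 ^ 3 + 2 ^ 3)) ∎
      where
      path-vertices : ∑[ p < a ] (deg (2 + p) ^ 3) ≡ a * 2 ^ 3
      path-vertices = trans (∑<-cong a (cong (_^ 3) ∘ deg-path)) (∑<-const a (2 ^ 3))
    leaves : ∑[ j < L ] (deg (k + j) ^ 3) ≡ L * 1 ^ 3
    leaves = trans (∑<-cong L (cong (_^ 3) ∘ deg-leaf)) (∑<-const L (1 ^ 3))

closed-form-increase : ∀ a t →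
  (2 + t) ^ 3 + (3 ^ 3 + (suc a * 2 ^ 3 + 2 ^ 3)) + t * 1 ^ 3 + 1 ^ 3 <
  (2 + suc t) ^ 3 + (3 ^ 3 + (a * 2 ^ 3 + 2 ^ 3)) + suc t * 1 ^ 3 + 1 ^ 3
closed-form-increase a t = <-≤-trans (m<m+n _ z<s) (≤-reflexive (sym (difference a t)))
  where
  difference : ∀ x y →
    (3 + y) * ((3 + y) * ((3 + y) * 1)) + (27 + (x * 8 + 8)) + (1 + y) * 1 + 1 ≡
    (2 + y) * ((2 + y) * ((2 + y) * 1)) + (27 + ((1 + x) * 8 + 8)) + y * 1 + 1 + (12 + 15 * y + 3 * (y * y))
  difference = solve-∀

theorem2 : (k n : ℕ) → 3 ≤ k → k + 2 ≤ n → Findex (G[ k ,2]^ n) > Findex (G[ k + 1 ,2]^ n)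
theorem2 k n 3≤k k+2≤n with m≤n⇒∃[o]m+o≡n 3≤k | m≤n⇒∃[o]m+o≡n k+2≤n
... | a , refl | t , refl = begin-strict
  Findex (G[ 3 + a + 1 ,2]^ (3 + a + 2 + t))
    ≡⟨ cong₂ (λ k n → Findex (G[ k ,2]^ n)) (k+1≡ a) (n≡′ a t) ⟩
  Findex (G[ 3 + suc a ,2]^ (4 + suc a + t))
    ≡⟨ Findex-closed-form (suc a) t ⟩
  _ <⟨ closed-form-increase a t ⟩
  _ ≡⟨ Findex-closed-form a (suc t) ⟨
  Findex (G[ 3 + a ,2]^ (4 + a + suc t))
    ≡⟨ cong (λ n → Findex (G[ 3 + a ,2]^ n)) (n≡ a t) ⟨
  Findex (G[ 3 + a ,2]^ (3 + a + 2 + t)) ∎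
  where
  open ≤-Reasoning
  k+1≡ : ∀ x → 3 + x + 1 ≡ 3 + suc x
  k+1≡ = solve-∀
  n≡ : ∀ x y → 3 + x + 2 + y ≡ 4 + x + suc y
  n≡ = solve-∀
  n≡′ : ∀ x y → 3 + x + 2 + y ≡ 4 + suc x + y
  n≡′ = solve-∀
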